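{- Let $\mathcal V=\langle A,\delta,\vec x_{in}\rangle$ be a VAS. A sequence $\pi=(u_i)_{0\le i\le k}$ of words over $A$ is productive in $\mathcal V$ for a word $a_1\cdots a_k$ (with $a_i\in A$) if and only if (1) the partial sums $\delta(u_0)+\cdots+\delta(u_j)$ are nonnegative for every $j\in\{0,\dots,k\}$, and (2) the word $u_0a_1u_1\cdots a_ku_k$ is fireable from $\vec x_{in}$.
   Context: A VAS of dimension $d$ is $\mathcal V=\langle A,\delta,\vec x_{in}\rangle$ with $A$ finite, $\delta:A\to\mathbb Z^d$ (extended to a monoid morphism on $A^*$), $\vec x_{in}\in\mathbb N^d$. For $\vec x,\vec y\in\mathbb N^d$, $\vec x\xrightarrow{a}\vec y$ iff $\vec y-\vec x=\delta(a)$, extended to words by composition; $u$ is fireable from $\vec x$ if $\vec x\xrightarrow{u}\vec y$ for some $\vec y\in\mathbb N^d$. A sequence $\pi=(u_i)_{0\le i\le k}$ of words over $A$ is productive in $\mathcal V$ for $a_1\cdots a_k$ if the words $u_0^na_1u_1^n\cdots a_ku_k^n$ are fireable from $\vec x_{in}$ for all $n\ge1$. A vector is nonnegative if all its components are $\ge0$. -}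

module Defs where

open import Data.Nat using (ℕ; zero; suc; _≤_)
open import Data.Integer using (ℤ; +_; _+_; 0ℤ) renaming (_≤_ to _≤ℤ_)
open import Data.Fin using (Fin; zero; suc; toℕ)
open import Data.List using (List; []; _∷_; _++_; concat; replicate)
open import Data.Product using (∃)
open import Relation.Binary.PropositionalEquality using (_≡_)

record VAS (m d : ℕ) : Set where
  field
    δ   : Fin m → (Fin d → ℤ)
    xin : Fin d → ℕ

Word : ℕ → Set
Word m = List (Fin m)

zeroV : ∀ {d} → Fin d → ℤ
zeroV _ = 0ℤ

_+V_ : ∀ {d} → (Fin d → ℤ) → (Fin d → ℤ) → (Fin d → ℤ)
(u +V v) i = u i + v i

Nonneg : ∀ {d} → (Fin d → ℤ) → Set
Nonneg v = ∀ i → 0ℤ ≤ℤ v i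

module _ {m d : ℕ} (V : VAS m d) where
  open VAS V

  δ* : Word m → (Fin d → ℤ)
  δ* []      = zeroV
  δ* (a ∷ w) = δ a +V δ* w

  Step : (Fin d → ℕ) → Fin m → (Fin d → ℕ) → Set
  Step x a y = ∀ i → + y i ≡ + x i + δ a i

  data Run : (Fin d → ℕ) → Word m → (Fin d → ℕ) → Set where
    run[] : ∀ {x} → Run x [] x
    run∷  : ∀ {x y z a w} → Step x a y → Run y w z → Run x (a ∷ w) z

  Fireable : (Fin d → ℕ) → Word m → Set
  Fireable x w = ∃ λ y → Run x w y

_^w_ : ∀ {m} → Word m → ℕ → Word m
w ^w n = concat (replicate n w)

-- u₀^n a₁ u₁^n ⋯ a_k u_k^n   for u : Fin (k+1) → Word, a : Fin k → A
-- (index i of a : Fin k stands for a_{i+1})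
pumped : ∀ {m} (k : ℕ) → (Fin (suc k) → Word m) → (Fin k → Fin m) → ℕ → Word m
pumped zero    u a n = u zero ^w n
pumped (suc k) u a n = (u zero ^w n) ++ (a zero ∷ pumped k (λ i → u (suc i)) (λ i → a (suc i)) n)

Productive : ∀ {m d} (V : VAS m d) (k : ℕ) → (Fin (suc k) → Word m) → (Fin k → Fin m) → Set
Productive V k u a = ∀ n → 1 ≤ n → Fireable V (VAS.xin V) (pumped k u a n)

partialSum : ∀ {m d} (V : VAS m d) (k : ℕ) → (Fin (suc k) → Word m) → Fin (suc k) → (Fin d → ℤ)
partialSum V k       u zero    = δ* V (u zero)
partialSum V (suc k) u (suc j) = δ* V (u zero) +V partialSum V k (λ i → u (suc i)) j

module Submission where

-- A run of a VAS stays in ℕ^d exactly when, on every coordinate i, the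
-- counter  x_i + δ(prefix)_i  is nonnegative along every prefix; so the
-- argument is carried out one coordinate at a time, for an integer
-- counter ('Safe'), and reassembled by 'fire→safe' / 'safe→fire'.
-- Two facts about the pumped word u₀ⁿa₁u₁ⁿ⋯a_ku_kⁿ give the two directions:
--   * 'pumped-safe': if the partial sums P_j = δ(u₀)+⋯+δ(u_j) are
--     nonnegative, a safe unpumped word stays safe after pumping: the
--     t-th copy of u_j starts at its unpumped start point shifted by
--     t·P_j + (n-1-t)·P_{j-1} ≥ 0, and safety is monotone in the start.
--   * 'pumped-prefix': the prefix of the pumped word ending with u_jⁿ has
--     weight n·P_j + e_j with e_j independent of n.  If every pumped word
--     is fireable these weights stay above -x_in for all n, which forces
--     P_j ≥ 0 ('slope-nonneg').

open import Defs
open import Data.Nat using (ℕ; zero; suc; s≤s; z≤n)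
import Data.Nat.Properties as ℕP
open import Data.Fin using (Fin; zero; suc)
open import Data.Product using (_×_; _,_; proj₁; proj₂; ∃; ∃₂)
open import Data.List using ([]; _∷_; _++_)
open import Data.List.Properties using (++-identityʳ; ++-assoc)
open import Data.Integer using (ℤ; +_; -[1+_]; 0ℤ; 1ℤ; -1ℤ; _+_; _*_; -_; ∣_∣; +≤+; -≤+; -≤-)
  renaming (_≤_ to _≤ℤ_)
import Data.Integer.Properties as ℤP
open import Data.Integer.Tactic.RingSolver using (solve-∀)
open import Function.Bundles using (_⇔_; mk⇔)
open import Relation.Nullary using (contradiction)
open import Relation.Binary.PropositionalEquality

≤-+-nonneg : ∀ {x c y} → 0ℤ ≤ℤ c → x + c ≡ y → x ≤ℤ y
≤-+-nonneg {x} c≥0 refl = subst (_≤ℤ x + _) (ℤP.+-identityʳ x) (ℤP.+-monoʳ-≤ x c≥0)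

*-nonneg : ∀ t {s} → 0ℤ ≤ℤ s → 0ℤ ≤ℤ + t * s
*-nonneg t {+ p} _ = subst (0ℤ ≤ℤ_) (ℤP.pos-* t p) (+≤+ z≤n)

i≤+∣i∣ : ∀ i → i ≤ℤ + ∣ i ∣
i≤+∣i∣ (+ n)    = ℤP.≤-refl
i≤+∣i∣ -[1+ n ] = -≤+

-- If x + ((n+1)·s + e) ≥ 0 for every n, the slope s is nonnegative:
-- for s ≤ -1, already n = ∣x + e∣ makes the quantity at most -1.
slope-nonneg : ∀ {x e s} → (∀ n → 0ℤ ≤ℤ x + (+ suc n * s + e)) → 0ℤ ≤ℤ s
slope-nonneg {s = + p} _ = +≤+ z≤n
slope-nonneg {x} {e} {s@(-[1+ p ])} nonneg = contradiction (ℤP.≤-trans (nonneg n) bound) λ ()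
  where
  open ℤP.≤-Reasoning
  c = x + e
  n = ∣ c ∣
  rearrange : ∀ x y e → x + (y + e) ≡ x + e + y
  rearrange = solve-∀
  cancel : ∀ a → a + - (1ℤ + a) ≡ -1ℤ
  cancel = solve-∀
  -- (n+1)·s is definitionally -[1+ p + n(p+1)], and n ≤ p + n(p+1)
  bound : x + (+ suc n * s + e) ≤ℤ -1ℤ
  bound = begin
    x + (+ suc n * s + e) ≡⟨ rearrange x (+ suc n * s) e ⟩
    c + + suc n * s       ≤⟨ ℤP.+-mono-≤ (i≤+∣i∣ c)
                               (-≤- (ℕP.≤-trans (ℕP.m≤m*n n (suc p)) (ℕP.m≤n+m _ p))) ⟩
    + n + -[1+ n ]        ≡⟨ cancel (+ n) ⟩
    -1ℤ                   ∎

module Coordinate {m d : ℕ} (V : VAS m d) (i : Fin d) where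
  open VAS V

  Δ : Word m → ℤ
  Δ w = δ* V w i

  Safe : ℤ → Word m → Set
  Safe x []      = 0ℤ ≤ℤ x
  Safe x (a ∷ w) = 0ℤ ≤ℤ x × Safe (x + δ a i) w

  Safe-start : ∀ {x} w → Safe x w → 0ℤ ≤ℤ x
  Safe-start []      x≥0       = x≥0
  Safe-start (a ∷ w) (x≥0 , _) = x≥0

  Safe-end : ∀ {x} w → Safe x w → 0ℤ ≤ℤ x + Δ w
  Safe-end {x} []      x≥0        = subst (0ℤ ≤ℤ_) (sym (ℤP.+-identityʳ x)) x≥0
  Safe-end {x} (a ∷ w) (_ , safe) = subst (0ℤ ≤ℤ_) (ℤP.+-assoc x _ _) (Safe-end w safe)

  Safe-mono : ∀ {x y} w → x ≤ℤ y → Safe x w → Safe y w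
  Safe-mono []      x≤y x≥0          = ℤP.≤-trans x≥0 x≤y
  Safe-mono (a ∷ w) x≤y (x≥0 , safe) =
    ℤP.≤-trans x≥0 x≤y , Safe-mono w (ℤP.+-monoˡ-≤ (δ a i) x≤y) safe

  Δ-++ : ∀ w v → Δ (w ++ v) ≡ Δ w + Δ v
  Δ-++ []      v = sym (ℤP.+-identityˡ (Δ v))
  Δ-++ (a ∷ w) v = trans (cong (_+_ (δ a i)) (Δ-++ w v)) (sym (ℤP.+-assoc (δ a i) (Δ w) (Δ v)))

  Δ-^ : ∀ w n → Δ (w ^w n) ≡ + n * Δ w
  Δ-^ w zero    = refl
  Δ-^ w (suc n) = begin
    Δ (w ++ w ^w n)       ≡⟨ Δ-++ w (w ^w n) ⟩
    Δ w + Δ (w ^w n)      ≡⟨ cong (_+_ (Δ w)) (Δ-^ w n) ⟩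
    Δ w + + n * Δ w       ≡⟨ sym (ℤP.suc-* (+ n) (Δ w)) ⟩
    + suc n * Δ w         ∎
    where open ≡-Reasoning

  Safe-++⁻ : ∀ {x} w {v} → Safe x (w ++ v) → Safe x w × Safe (x + Δ w) v
  Safe-++⁻ {x} [] {v} safe =
    Safe-start v safe , subst (λ y → Safe y v) (sym (ℤP.+-identityʳ x)) safe
  Safe-++⁻ {x} (a ∷ w) {v} (x≥0 , safe) with Safe-++⁻ w safe
  ... | safe-w , safe-v = (x≥0 , safe-w) , subst (λ y → Safe y v) (ℤP.+-assoc x _ _) safe-v

  Safe-++⁺ : ∀ {x} w {v} → Safe x w → Safe (x + Δ w) v → Safe x (w ++ v)
  Safe-++⁺ {x} [] {v} _ safe-v = subst (λ y → Safe y v) (ℤP.+-identityʳ x) safe-v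
  Safe-++⁺ {x} (a ∷ w) {v} (x≥0 , safe-w) safe-v =
    x≥0 , Safe-++⁺ w safe-w (subst (λ y → Safe y v) (sym (ℤP.+-assoc x _ _)) safe-v)

  Safe-prefix : ∀ {x} p {v} → Safe x (p ++ v) → 0ℤ ≤ℤ x + Δ p
  Safe-prefix p {v} safe = Safe-start v (proj₂ (Safe-++⁻ p safe))

  -- Induction on t: in w·w^(t+1) the tail w^(t+1) starts at
  -- (x + t·s) + (s + Δw), above the start x + t·s it is safe from.
  Safe-^ : ∀ {x s} w → Safe x w → 0ℤ ≤ℤ s → 0ℤ ≤ℤ s + Δ w →
           ∀ t → Safe (x + + t * s) (w ^w suc t)
  Safe-^ {x} {s} w safe s≥0 s+w≥0 t =
    Safe-++⁺ w (Safe-mono w (≤-+-nonneg (*-nonneg t s≥0) refl) safe) (later-copies t)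
    where
    shift : ∀ x s w t → x + t * s + (s + w) ≡ x + (1ℤ + t) * s + w
    shift = solve-∀
    later-copies : ∀ t → Safe (x + + t * s + Δ w) (w ^w t)
    later-copies zero    = subst (λ y → 0ℤ ≤ℤ y + Δ w) (sym (ℤP.+-identityʳ x)) (Safe-end w safe)
    later-copies (suc t) = Safe-mono (w ^w suc t)
                             (≤-+-nonneg s+w≥0 (shift x s (Δ w) (+ t)))
                             (Safe-^ w safe s≥0 s+w≥0 t)

  P : ∀ k → (Fin (suc k) → Word m) → Fin (suc k) → ℤ
  P k u j = partialSum V k u j i

  -- Pumping preserves safety when all partial sums are nonnegative
  -- (offset by some s ≥ 0, the partial sum of the blocks already passed).
  pumped-safe : ∀ k u a {x s} → 0ℤ ≤ℤ s → (∀ j → 0ℤ ≤ℤ s + P k u j) →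
                Safe x (pumped k u a 1) → ∀ n → Safe (x + + n * s) (pumped k u a (suc n))
  pumped-safe zero u a s≥0 sums≥0 safe =
    Safe-^ (u zero) (proj₁ (Safe-++⁻ (u zero) safe)) s≥0 (sums≥0 zero)
  pumped-safe (suc k) u a {x} {s} s≥0 sums≥0 safe n =
    Safe-++⁺ (u₀ ^w suc n) (Safe-^ u₀ safe-u₀ s≥0 s′≥0 n)
      (subst (λ y → Safe y (a zero ∷ rest (suc n))) next-start (next≥0 , safe-rest))
    where
    u₀ = u zero
    u′ = λ j → u (suc j)
    a′ = λ j → a (suc j)
    rest : ℕ → Word m
    rest = pumped k u′ a′
    s′ = s + Δ u₀
    s′≥0 : 0ℤ ≤ℤ s′
    s′≥0 = sums≥0 zero
    split₁ : Safe x u₀ × Safe (x + Δ u₀) (a zero ∷ rest 1)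
    split₁ = Safe-++⁻ u₀ (subst (λ w → Safe x (w ++ a zero ∷ rest 1)) (++-identityʳ u₀) safe)
    safe-u₀ = proj₁ split₁
    -- after u₀ⁿ⁺¹ the counter exceeds its unpumped value x + Δu₀ by n·s′ ≥ 0
    next≥0 : 0ℤ ≤ℤ x + Δ u₀ + + n * s′
    next≥0 = ℤP.≤-trans (proj₁ (proj₂ split₁)) (≤-+-nonneg (*-nonneg n s′≥0) refl)
    -- the remaining blocks see the partial sums shifted by s′
    safe-rest : Safe (x + Δ u₀ + + n * s′ + δ (a zero) i) (rest (suc n))
    safe-rest = subst (λ y → Safe y (rest (suc n))) (swap (x + Δ u₀) (δ (a zero) i) (+ n * s′))
      (pumped-safe k u′ a′ s′≥0 (λ j → subst (0ℤ ≤ℤ_) (sym (ℤP.+-assoc s _ _)) (sums≥0 (suc j)))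
        (proj₂ (proj₂ split₁)) n)
      where
      swap : ∀ y z t → y + z + t ≡ y + t + z
      swap = solve-∀
    next-start : x + Δ u₀ + + n * s′ ≡ x + + n * s + Δ (u₀ ^w suc n)
    next-start = begin
      x + Δ u₀ + + n * s′               ≡⟨ regroup x s (Δ u₀) (+ n) ⟩
      x + + n * s + (Δ u₀ + + n * Δ u₀) ≡⟨ cong (_+_ (x + + n * s)) (sym (ℤP.suc-* (+ n) (Δ u₀))) ⟩
      x + + n * s + + suc n * Δ u₀      ≡⟨ cong (_+_ (x + + n * s)) (sym (Δ-^ u₀ (suc n))) ⟩
      x + + n * s + Δ (u₀ ^w suc n)     ∎
      where
      open ≡-Reasoning
      regroup : ∀ x s w n → x + w + n * (s + w) ≡ x + n * s + (w + n * w)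
      regroup = solve-∀

  pumped-head : ∀ k (u : Fin (suc k) → Word m) (a : Fin k → Fin m) n →
                ∃ λ v → pumped k u a n ≡ u zero ^w n ++ v
  pumped-head zero    u a n = [] , sym (++-identityʳ _)
  pumped-head (suc k) u a n = _ , refl

  pumped-prefix : ∀ k u a (j : Fin (suc k)) →
    ∃ λ e → ∀ n → ∃₂ λ p v → pumped k u a n ≡ p ++ v × Δ p ≡ + n * P k u j + e
  pumped-prefix k u a zero = 0ℤ , λ n →
    let (v , split) = pumped-head k u a n
    in u zero ^w n , v , split , trans (Δ-^ (u zero) n) (sym (ℤP.+-identityʳ _))
  pumped-prefix (suc k) u a (suc j) =
    let (e , prefix) = pumped-prefix k u′ a′ j
    in b + e , λ n →
      let (p , v , split , weight) = prefix n
          block = u₀ ^w n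
      in block ++ a zero ∷ p , v
       , trans (cong (λ w → block ++ a zero ∷ w) split) (sym (++-assoc block (a zero ∷ p) v))
       , (begin
           Δ (block ++ a zero ∷ p)                  ≡⟨ Δ-++ block (a zero ∷ p) ⟩
           Δ block + (b + Δ p)                      ≡⟨ cong₂ (λ y z → y + (b + z)) (Δ-^ u₀ n) weight ⟩
           + n * Δ u₀ + (b + (+ n * P k u′ j + e))  ≡⟨ regroup (+ n) (Δ u₀) b (P k u′ j) e ⟩
           + n * P (suc k) u (suc j) + (b + e)      ∎)
    where
    open ≡-Reasoning
    u₀ = u zero
    u′ = λ j → u (suc j)
    a′ = λ j → a (suc j)
    b = δ (a zero) i
    regroup : ∀ n w b q e → n * w + (b + (n * q + e)) ≡ n * (w + q) + (b + e)
    regroup = solve-∀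

open Coordinate using (Safe; Safe-start; Safe-prefix; pumped-safe; pumped-prefix)

fire→safe : ∀ {m d} (V : VAS m d) {x y w} → Run V x w y → ∀ i → Safe V i (+ x i) w
fire→safe V run[]                i = +≤+ z≤n
fire→safe V (run∷ {w = w} step run) i =
  +≤+ z≤n , subst (λ z → Safe V i z w) (step i) (fire→safe V run i)

safe→fire : ∀ {m d} (V : VAS m d) x w → (∀ i → Safe V i (+ x i) w) → Fireable V x w
safe→fire V x []      _    = x , run[]
safe→fire {d = d} V x (a ∷ w) safe =
  let (z , run) = safe→fire V y w (λ i → subst (λ c → Safe V i c w) (sym (step i)) (proj₂ (safe i)))
  in z , run∷ step run
  where
  open VAS V
  y : Fin d → ℕ
  y i = ∣ + x i + δ a i ∣
  step : ∀ i → + y i ≡ + x i + δ a i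
  step i = ℤP.0≤i⇒+∣i∣≡i (Safe-start V i w (proj₂ (safe i)))

lemma4p3 : ∀ {m d : ℕ} (V : VAS m d) (k : ℕ) (u : Fin (suc k) → Word m) (a : Fin k → Fin m) →
    Productive V k u a ⇔ (((j : Fin (suc k)) → Nonneg (partialSum V k u j)) × Fireable V (VAS.xin V) (pumped k u a 1))
lemma4p3 V k u a = mk⇔ necessary sufficient
  where
  open VAS V

  necessary : Productive V k u a →
    ((j : Fin (suc k)) → Nonneg (partialSum V k u j)) × Fireable V xin (pumped k u a 1)
  necessary productive = partial-sums≥0 , productive 1 (s≤s z≤n)
    where
    partial-sums≥0 : (j : Fin (suc k)) → Nonneg (partialSum V k u j)
    partial-sums≥0 j i =
      let (e , prefix) = pumped-prefix V i k u a j
      in slope-nonneg {x = + xin i} {e} λ n →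
        let (p , v , split , weight) = prefix (suc n)
            (_ , run) = productive (suc n) (s≤s z≤n)
        in subst (λ z → 0ℤ ≤ℤ + xin i + z) weight
             (Safe-prefix V i p (subst (Safe V i (+ xin i)) split (fire→safe V run i)))

  sufficient : ((j : Fin (suc k)) → Nonneg (partialSum V k u j)) × Fireable V xin (pumped k u a 1) →
    Productive V k u a
  sufficient (partial-sums≥0 , (_ , run)) (suc n) _ = safe→fire V xin (pumped k u a (suc n)) λ i →
    subst (λ z → Safe V i z _) (no-offset (+ xin i))
      (pumped-safe V i k u a ℤP.≤-refl
        (λ j → subst (0ℤ ≤ℤ_) (sym (ℤP.+-identityˡ _)) (partial-sums≥0 j i))
        (fire→safe V run i) n)
    where
    no-offset : ∀ x → x + + n * 0ℤ ≡ x
    no-offset x = trans (cong (_+_ x) (ℤP.*-zeroʳ (+ n))) (ℤP.+-identityʳ x)
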